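{- Let $3\le p<q$ be relatively prime integers, let $s$ be an integer with $3\le s<q$ and $\gcd(s,pq)=1$, and put $r=pq+s$. Then for all integers $k$ and $j$ with $|j|<s$, \[ \chi(kr+j)=\chi'(ks+j). \]
   Context: For pairwise relatively prime integers $p,q,t\ge 3$, every integer $n$ has a unique representation $n=x_nqt+y_ntp+z_npq+\delta_npqt$ with $0\le x_n<p$, $0\le y_n<q$, $0\le z_n<t$, $\delta_n\in\mathbb Z$; $n$ is called $\{p,q,t\}$-representable if $\delta_n\ge 0$. Here $\chi$ is the characteristic function of $\{p,q,r\}$-representable integers and $\chi'$ is the characteristic function of $\{p,q,s\}$-representable integers. -}

module Defs where

open import Data.Nat using (ℕ; _<_)
open import Data.Integer using (ℤ; +_; _+_; _*_)
open import Data.Product using (Σ; _×_)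
open import Relation.Binary.PropositionalEquality using (_≡_)

-- n is {p,q,t}-representable: in its (unique, for pairwise coprime p,q,t)
-- representation n = x qt + y tp + z pq + δ pqt with 0≤x<p, 0≤y<q, 0≤z<t,
-- the coefficient δ is ≥ 0.  Since the representation is unique, this is
-- the same as the existence of such a representation with δ ∈ ℕ.
Representable : ℕ → ℕ → ℕ → ℤ → Set
Representable p q t n =
  Σ ℕ λ x → Σ ℕ λ y → Σ ℕ λ z → Σ ℕ λ δ →
    x < p × y < q × z < t ×
    n ≡ + x * (+ q * + t) + + y * (+ t * + p) + + z * (+ p * + q)
        + + δ * (+ p * + q * + t)

module Submission where

-- Write a candidate representation of n as
--   n = x·qt + y·tp + M·pq   with 0 ≤ x < p, 0 ≤ y < q, M ∈ ℕ;
-- since z + δt runs over all of ℕ when 0 ≤ z < t and δ ∈ ℕ, n is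
-- {p,q,t}-representable iff such x, y, M exist.  For n = kt + j this says
-- that for some x < p, y < q the cofactor K = k - (xq + yp) makes Kt + j a
-- non-negative multiple of P = pq (representable⇔cofactorRep).  Thus the
-- theorem reduces to the one-variable statement, for every K ∈ ℤ and
-- |j| < s ≤ P:
--   K(P+s) + j ∈ Pℕ   ⇔   Ks + j ∈ Pℕ                  (cofactor-shift)
-- If K < 0 both sides are negative (|j| < s), so both fail.  If K ≥ 0,
-- K(P+s) + j = KP + (Ks + j) and Ks + j > -s ≥ -P; a number m > -P
-- satisfies KP + m ∈ Pℕ iff m ∈ Pℕ, because the only multiples of P above
-- -P are the non-negative ones (multiple-above).

open import Defs
open import Data.Nat using (ℕ; _≤_; _<_; _+_; _*_)
open import Data.Nat.Coprimality using (Coprime)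
open import Data.Integer using (ℤ; +_; ∣_∣)
open import Data.Integer using () renaming (_+_ to _+ℤ_; _*_ to _*ℤ_)
open import Function.Bundles using (_⇔_)

open import Data.Nat using (suc; NonZero; >-nonZero; z≤n; s≤s; s<s⁻¹; _%_; _/_)
import Data.Nat.Properties as ℕ
open import Data.Nat.DivMod using (m≡m%n+[m/n]*n; m%n<n)
open import Data.Integer using (-[1+_]; -_; _-_; -1ℤ; 0ℤ; +≤+; -≤-; +<+; -<-; -<+)
  renaming (_≤_ to _≤ℤ_; _<_ to _<ℤ_)
import Data.Integer.Properties as ℤ
open import Data.Integer.Tactic.RingSolver using (solve-∀)
open import Data.Product using (Σ; _×_; _,_; proj₁; proj₂)
open import Data.Empty using (⊥; ⊥-elim)
open import Function.Bundles using (mk⇔; module Equivalence)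
import Function.Properties.Equivalence as ⇔
open import Relation.Binary.PropositionalEquality
  using (_≡_; refl; sym; trans; cong; cong₂; subst; module ≡-Reasoning)

NonNegMultiple : ℕ → ℤ → Set
NonNegMultiple P n = Σ ℕ λ M → n ≡ + P *ℤ + M

nonNegMultiple-nonNeg : ∀ {P n} → NonNegMultiple P n → 0ℤ ≤ℤ n
nonNegMultiple-nonNeg {P} (M , refl) = subst (0ℤ ≤ℤ_) (ℤ.pos-* P M) (+≤+ z≤n)

abs-bound : ∀ {t} {j : ℤ} → ∣ j ∣ < t → - + t <ℤ j × j <ℤ + t
abs-bound {suc t} {+ n}      ∣j∣<t = -<+ , +<+ ∣j∣<t
abs-bound {suc t} { -[1+ n ]} ∣j∣<t = -<- (s<s⁻¹ ∣j∣<t) , -<+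

negative-coefficient : ∀ a t (j : ℤ) → ∣ j ∣ < t → -[1+ a ] *ℤ + t +ℤ j <ℤ 0ℤ
negative-coefficient a (suc t) j ∣j∣<t = begin-strict
  -[1+ a ] *ℤ + suc t +ℤ j   <⟨ ℤ.+-mono-≤-< a·t≤-t (proj₂ (abs-bound {j = j} ∣j∣<t)) ⟩
  - + suc t +ℤ + suc t       ≡⟨ ℤ.+-inverseˡ (+ suc t) ⟩
  0ℤ                         ∎
  where
  open ℤ.≤-Reasoning
  a·t≤-t : -[1+ a ] *ℤ + suc t ≤ℤ - + suc t
  a·t≤-t = -≤- (ℕ.m≤m+n t _)

multiple-above : ∀ P (d : ℤ) → - + P <ℤ + P *ℤ d → NonNegMultiple P (+ P *ℤ d)
multiple-above P (+ e)      _     = e , refl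
multiple-above P -[1+ e ] -P<Pd
  with ℤ.*-cancelˡ-<-nonNeg (+ P) (subst (_<ℤ + P *ℤ -[1+ e ]) -P≡P·-1 -P<Pd)
  where
  -P≡P·-1 : - + P ≡ + P *ℤ -1ℤ
  -P≡P·-1 = trans (sym (ℤ.-1*i≡-i (+ P))) (ℤ.*-comm -1ℤ (+ P))
... | -<- ()

multiple-shift : ∀ P a (m : ℤ) → - + P <ℤ m →
  NonNegMultiple P (+ a *ℤ + P +ℤ m) ⇔ NonNegMultiple P m
multiple-shift P a m -P<m = mk⇔ to from
  where
  to : NonNegMultiple P (+ a *ℤ + P +ℤ m) → NonNegMultiple P m
  to (N , eq) = subst (NonNegMultiple P) (sym m≡)
    (multiple-above P (+ N - + a) (subst (- + P <ℤ_) m≡ -P<m))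
    where
    cancel : ∀ u m → m ≡ u +ℤ m - u
    cancel = solve-∀
    factor : ∀ a P N → P *ℤ N - a *ℤ P ≡ P *ℤ (N - a)
    factor = solve-∀
    m≡ : m ≡ + P *ℤ (+ N - + a)
    m≡ = begin
      m                             ≡⟨ cancel (+ a *ℤ + P) m ⟩
      + a *ℤ + P +ℤ m - + a *ℤ + P  ≡⟨ cong (_- + a *ℤ + P) eq ⟩
      + P *ℤ + N - + a *ℤ + P       ≡⟨ factor (+ a) (+ P) (+ N) ⟩
      + P *ℤ (+ N - + a)            ∎
      where open ≡-Reasoning
  from : NonNegMultiple P m → NonNegMultiple P (+ a *ℤ + P +ℤ m)
  from (M , refl) = M + a , trans (collect (+ a) (+ P) (+ M)) (cong (+ P *ℤ_) (sym (ℤ.pos-+ M a)))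
    where
    collect : ∀ a P M → a *ℤ P +ℤ P *ℤ M ≡ P *ℤ (M +ℤ a)
    collect = solve-∀

cofactor-shift : ∀ P s (K j : ℤ) → s ≤ P → ∣ j ∣ < s →
  NonNegMultiple P (K *ℤ + (P + s) +ℤ j) ⇔ NonNegMultiple P (K *ℤ + s +ℤ j)
cofactor-shift P s -[1+ a ] j _ ∣j∣<s =
  mk⇔ (λ mult → ⊥-elim (impossible (ℕ.<-≤-trans ∣j∣<s (ℕ.m≤n+m s P)) mult))
      (λ mult → ⊥-elim (impossible ∣j∣<s mult))
  where
  impossible : ∀ {t} → ∣ j ∣ < t → NonNegMultiple P (-[1+ a ] *ℤ + t +ℤ j) → ⊥
  impossible {t} ∣j∣<t mult =
    ℤ.<⇒≱ (negative-coefficient a t j ∣j∣<t) (nonNegMultiple-nonNeg {P} mult)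
cofactor-shift P s (+ a) j s≤P ∣j∣<s =
  subst (λ n → NonNegMultiple P n ⇔ NonNegMultiple P (+ a *ℤ + s +ℤ j)) (sym split)
    (multiple-shift P a (+ a *ℤ + s +ℤ j) -P<m)
  where
  split : + a *ℤ + (P + s) +ℤ j ≡ + a *ℤ + P +ℤ (+ a *ℤ + s +ℤ j)
  split = trans (cong (λ t → + a *ℤ t +ℤ j) (ℤ.pos-+ P s)) (distrib (+ a) (+ P) (+ s) j)
    where
    distrib : ∀ a P s j → a *ℤ (P +ℤ s) +ℤ j ≡ a *ℤ P +ℤ (a *ℤ s +ℤ j)
    distrib = solve-∀
  -P<m : - + P <ℤ + a *ℤ + s +ℤ j
  -P<m = begin-strict
    - + P               ≤⟨ ℤ.neg-mono-≤ (+≤+ s≤P) ⟩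
    - + s               <⟨ proj₁ (abs-bound {j = j} ∣j∣<s) ⟩
    j                   ≡⟨ sym (ℤ.+-identityˡ j) ⟩
    0ℤ +ℤ j             ≤⟨ ℤ.+-monoˡ-≤ j 0≤as ⟩
    + a *ℤ + s +ℤ j     ∎
    where
    open ℤ.≤-Reasoning
    0≤as : 0ℤ ≤ℤ + a *ℤ + s
    0≤as = subst (0ℤ ≤ℤ_) (ℤ.pos-* a s) (+≤+ z≤n)

CofactorRep : ℕ → ℕ → ℕ → ℤ → ℤ → Set
CofactorRep p q t k j = Σ ℕ λ x → Σ ℕ λ y → x < p × y < q ×
  NonNegMultiple (p * q) ((k - (+ x *ℤ + q +ℤ + y *ℤ + p)) *ℤ + t +ℤ j)

-- The remainder z < t and the quotient δ ≥ 0 merge into the single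
-- coefficient z + δt ∈ ℕ of pq, and every natural number arises this way.
representable⇔cofactorRep : ∀ p q t (k j : ℤ) → .{{_ : NonZero t}} →
  Representable p q t (k *ℤ + t +ℤ j) ⇔ CofactorRep p q t k j
representable⇔cofactorRep p q t k j = mk⇔ to from
  where
  offset : ℕ → ℕ → ℤ
  offset x y = + x *ℤ + q +ℤ + y *ℤ + p

  expansion : ∀ x y z δ p q t →
    x *ℤ (q *ℤ t) +ℤ y *ℤ (t *ℤ p) +ℤ z *ℤ (p *ℤ q) +ℤ δ *ℤ (p *ℤ q *ℤ t)
      ≡ (x *ℤ q +ℤ y *ℤ p) *ℤ t +ℤ (p *ℤ q) *ℤ (z +ℤ δ *ℤ t)
  expansion = solve-∀

  cast : ∀ z δ → + (p * q) *ℤ + (z + δ * t) ≡ (+ p *ℤ + q) *ℤ (+ z +ℤ + δ *ℤ + t)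
  cast z δ = cong₂ _*ℤ_ (ℤ.pos-* p q) (trans (ℤ.pos-+ z (δ * t)) (cong (+ z +ℤ_) (ℤ.pos-* δ t)))

  unshift : ∀ o c → (k - o) *ℤ + t +ℤ j ≡ c → k *ℤ + t +ℤ j ≡ o *ℤ + t +ℤ c
  unshift o c eq = trans (regroup k o (+ t) j) (cong (o *ℤ + t +ℤ_) eq)
    where
    regroup : ∀ k o t j → k *ℤ t +ℤ j ≡ o *ℤ t +ℤ ((k - o) *ℤ t +ℤ j)
    regroup = solve-∀

  shift : ∀ o c → k *ℤ + t +ℤ j ≡ o *ℤ + t +ℤ c → (k - o) *ℤ + t +ℤ j ≡ c
  shift o c eq = trans (regroup k o (+ t) j) (trans (cong (_- o *ℤ + t) eq) (cancel o (+ t) c))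
    where
    regroup : ∀ k o t j → (k - o) *ℤ t +ℤ j ≡ (k *ℤ t +ℤ j) - o *ℤ t
    regroup = solve-∀
    cancel : ∀ o t c → o *ℤ t +ℤ c - o *ℤ t ≡ c
    cancel = solve-∀

  to : Representable p q t (k *ℤ + t +ℤ j) → CofactorRep p q t k j
  to (x , y , z , δ , x<p , y<q , _ , eq) = x , y , x<p , y<q , z + δ * t ,
    shift (offset x y) _ (trans eq (trans (expansion (+ x) (+ y) (+ z) (+ δ) (+ p) (+ q) (+ t))
                                          (cong (offset x y *ℤ + t +ℤ_) (sym (cast z δ)))))

  from : CofactorRep p q t k j → Representable p q t (k *ℤ + t +ℤ j)
  from (x , y , x<p , y<q , M , eq) = x , y , M % t , M / t , x<p , y<q , m%n<n M t , (begin
    k *ℤ + t +ℤ j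
      ≡⟨ unshift (offset x y) _ eq ⟩
    offset x y *ℤ + t +ℤ + (p * q) *ℤ + M
      ≡⟨ cong (λ n → offset x y *ℤ + t +ℤ + (p * q) *ℤ + n) (m≡m%n+[m/n]*n M t) ⟩
    offset x y *ℤ + t +ℤ + (p * q) *ℤ + (M % t + M / t * t)
      ≡⟨ cong (offset x y *ℤ + t +ℤ_) (cast (M % t) (M / t)) ⟩
    offset x y *ℤ + t +ℤ (+ p *ℤ + q) *ℤ (+ (M % t) +ℤ + (M / t) *ℤ + t)
      ≡⟨ sym (expansion (+ x) (+ y) (+ (M % t)) (+ (M / t)) (+ p) (+ q) (+ t)) ⟩
    + x *ℤ (+ q *ℤ + t) +ℤ + y *ℤ (+ t *ℤ + p) +ℤ + (M % t) *ℤ (+ p *ℤ + q)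
      +ℤ + (M / t) *ℤ (+ p *ℤ + q *ℤ + t) ∎)
    where open ≡-Reasoning

cofactorRep-shift : ∀ p q s (k j : ℤ) → s ≤ p * q → ∣ j ∣ < s →
  CofactorRep p q (p * q + s) k j ⇔ CofactorRep p q s k j
cofactorRep-shift p q s k j s≤pq ∣j∣<s = mk⇔
  (λ (x , y , x<p , y<q , mult) → x , y , x<p , y<q , Equivalence.to (shift-at x y) mult)
  (λ (x , y , x<p , y<q , mult) → x , y , x<p , y<q , Equivalence.from (shift-at x y) mult)
  where
  cofactor : ℕ → ℕ → ℤ
  cofactor x y = k - (+ x *ℤ + q +ℤ + y *ℤ + p)
  shift-at : ∀ x y → NonNegMultiple (p * q) (cofactor x y *ℤ + (p * q + s) +ℤ j)
                   ⇔ NonNegMultiple (p * q) (cofactor x y *ℤ + s +ℤ j)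
  shift-at x y = cofactor-shift (p * q) s (cofactor x y) j s≤pq ∣j∣<s

lemma8 : (p q s : ℕ) → 3 ≤ p → p < q → Coprime p q →
    3 ≤ s → s < q → Coprime s (p * q) →
    (k j : ℤ) → ∣ j ∣ < s →
    Representable p q (p * q + s) (k *ℤ + (p * q + s) +ℤ j)
      ⇔ Representable p q s (k *ℤ + s +ℤ j)
lemma8 p q s 3≤p _ _ 3≤s s<q _ k j ∣j∣<s =
  ⇔.trans (representable⇔cofactorRep p q (p * q + s) k j)
    (⇔.trans (cofactorRep-shift p q s k j s≤pq ∣j∣<s)
      (⇔.sym (representable⇔cofactorRep p q s k j)))
  where
  instance
    p≢0 : NonZero p
    p≢0 = >-nonZero (ℕ.≤-trans (s≤s z≤n) 3≤p)
    s≢0 : NonZero s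
    s≢0 = >-nonZero (ℕ.≤-trans (s≤s z≤n) 3≤s)
    pq+s≢0 : NonZero (p * q + s)
    pq+s≢0 = >-nonZero (ℕ.≤-trans (s≤s z≤n) (ℕ.≤-trans 3≤s (ℕ.m≤n+m s (p * q))))
  s≤pq : s ≤ p * q
  s≤pq = ℕ.≤-trans (ℕ.<⇒≤ s<q) (ℕ.m≤n*m q p)
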